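{- No family of automata networks of polynomial ball growth can be strongly universal.
   Context: An automata network over a finite alphabet $Q$ on finite node set $V$ is a map $F:Q^V\to Q^V$; a directed graph on $V$ is a communication graph of $F$ if each $F(x)_v$ depends only on $x$ restricted to the in-neighbours of $v$. A family of finite graphs $(G_i)_{i\in I}$ has polynomial ball growth if there is $k\in\mathbb N$ such that for every $m$ there is a constant $C_m$ such that for every $i\in I$, every set $X$ of $m$ vertices of $G_i$ and every $n$, $|B(X,n)|\le C_mn^k$, where $B(X,n)$ is the set of vertices at distance at most $n$ from $X$ in $G_i$. A family of automata networks has polynomial ball growth if the family of its underlying communication graphs has. Representations and simulation. For each finite alphabet fix an injective $m_Q:Q\to\{0,1\}^{k_Q}$ extended cellwise; a circuit encoding of $F:Q^n\to Q^n$ is a Boolean circuit $C$ with $m_Q\circ F=C\circ m_Q$. A standard representation of a family is a language with a logarithmic-space algorithm producing a circuit encoding of a member from each word, all members being represented. A block embedding of $Q_F^{V_F}$ into $Q_G^{V_G}$ is a partition $(D_i)_{i\in V_F}$ of $V_G$ with patterns $p_{i,q}\in Q_G^{D_i}$ injective in $q$, giving $\phi(x)|_{D_i}=p_{i,x_i}$; $G$ simulates $F$ via $\phi$ with time constant $T$ if $\phi\circ F=G^T\circ\phi$. A family $(\mathcal F,\mathcal F^*)$ simulates $(\mathcal H,\mathcal H^*)$ in time $T$ and space $S$ if a logarithmic-space Turing machine maps each word representing $H:Q_H^n\to Q_H^n$ to a word representing $F\in\mathcal F$ on $S(n)$ nodes, the number $T(n)$ and a block embedding via which $F$ simulates $H$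 with time constant $T(n)$. $\mathcal B_{Q,\Delta}$ is the family of networks over $Q$ with a communication graph of maximum degree $\le\Delta$, represented by such a graph plus local transition tables. A family is strongly universal if for all finite $Q$ and all $\Delta\ge1$ it simulates $\mathcal B_{Q,\Delta}$ in constant time $T$ and linear space $S$. -}

module Defs where

open import Data.Nat using (ℕ; zero; suc; _+_; _*_; _^_; _≤_; _≤ᵇ_; pred)
open import Data.Nat.Logarithm using (⌊log₂_⌋)
open import Data.Fin using (Fin; zero; suc; toℕ; combine; _≟_)
open import Data.Bool using (Bool; true; false; if_then_else_)
open import Data.Maybe using (Maybe; just; nothing)
open import Data.List using (List; []; _∷_; _++_; length; map; concat; replicate; reverse; allFin; [_])
open import Data.List.Membership.Propositional using (_∈_)
open import Data.Product using (Σ; _×_; _,_)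
open import Data.Sum using (_⊎_)
open import Relation.Nullary using (¬_)
open import Relation.Nullary.Decidable using (⌊_⌋)
open import Relation.Binary.PropositionalEquality using (_≡_)
open import Function.Definitions using (Injective)

record AN : Set where
  field
    q : ℕ
    n : ℕ
    F : (Fin n → Fin q) → (Fin n → Fin q)

iter : {A : Set} → (A → A) → ℕ → A → A
iter f zero    x = x
iter f (suc t) x = f (iter f t x)

-- E u v means: u is an in-neighbour of v (edge u → v).
IsCommGraph : (A : AN) → (Fin (AN.n A) → Fin (AN.n A) → Set) → Set
IsCommGraph A E = ∀ (v : Fin (AN.n A)) (x y : Fin (AN.n A) → Fin (AN.q A)) →
  (∀ u → E u v → x u ≡ y u) → AN.F A x v ≡ AN.F A y v

-- Cardinality bound: |S| ≤ b iff there is no injection Fin (b+1) → S.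

CardLE : {N : ℕ} → (Fin N → Set) → ℕ → Set
CardLE {N} S b = (f : Fin (suc b) → Fin N) → Injective _≡_ _≡_ f → ¬ (∀ j → S (f j))

-- Paths of length ≤ r in the graph (distance taken in the underlying
-- undirected graph).
data Within {N : ℕ} (E : Fin N → Fin N → Set) : ℕ → Fin N → Fin N → Set where
  here : ∀ {r u} → Within E r u u
  step : ∀ {r u w v} → (E u w ⊎ E w u) → Within E r w v → Within E (suc r) u v

Ball : {N m : ℕ} → (Fin N → Fin N → Set) → (Fin m → Fin N) → ℕ → Fin N → Set
Ball {m = m} E X r v = Σ (Fin m) λ j → Within E r (X j) v

PolyBallGrowth : (I : Set) (N : I → ℕ) (E : (i : I) → Fin (N i) → Fin (N i) → Set) → Set
PolyBallGrowth I N E =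
  Σ ℕ λ k → ∀ (m : ℕ) → Σ ℕ λ C →
    ∀ (i : I) (X : Fin m → Fin (N i)) → Injective _≡_ _≡_ X →
    ∀ (r : ℕ) → 1 ≤ r → CardLE (Ball (E i) X r) (C * r ^ k)

-- Turing machines with a read-only input tape (with end markers),
-- one work tape (alphabet Fin (suc nW), blank = zero) and a write-only
-- output tape over {0,1}.

data Move : Set where
  mL mS mR : Move

record TM : Set where
  field
    nS    : ℕ
    nW    : ℕ
    start : Fin nS
    -- nothing = halt; otherwise (new state, input move, written work
    -- symbol, work move, optional output bit)
    δ     : Fin nS → Maybe Bool → Fin (suc nW) →
            Maybe (Fin nS × Move × Fin (suc nW) × Move × Maybe Bool)

record Config (M : TM) : Set where
  constructor cfg
  field
    st    : Fin (TM.nS M)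
    ipos  : ℕ                      -- 0 = left end marker, length w + 1 = right end marker
    left  : List (Fin (suc (TM.nW M)))   -- reversed
    cur   : Fin (suc (TM.nW M))
    right : List (Fin (suc (TM.nW M)))
    outR  : List Bool              -- output so far, reversed

nth : List Bool → ℕ → Maybe Bool
nth []       _       = nothing
nth (b ∷ bs) zero    = just b
nth (b ∷ bs) (suc i) = nth bs i

readIn : List Bool → ℕ → Maybe Bool
readIn w zero    = nothing
readIn w (suc i) = nth w i

moveIn : List Bool → Move → ℕ → ℕ
moveIn w mL p = pred p
moveIn w mS p = p
moveIn w mR p = if p ≤ᵇ length w then suc p else p

moveWork : {A : Set} → A → Move → List A → A → List A → (List A × A × List A)
moveWork blank mL []       c rs = ([] , c , rs)
moveWork blank mL (l ∷ ls) c rs = (ls , l , c ∷ rs)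
moveWork blank mS ls       c rs = (ls , c , rs)
moveWork blank mR ls       c [] = (c ∷ ls , blank , [])
moveWork blank mR ls       c (r ∷ rs) = (c ∷ ls , r , rs)

writeOut : Maybe Bool → List Bool → List Bool
writeOut nothing  o = o
writeOut (just b) o = b ∷ o

stepTM : (M : TM) → List Bool → Config M → Maybe (Config M)
stepTM M w (cfg s p ls c rs o) with TM.δ M s (readIn w p) c
... | nothing = nothing
... | just (s' , mi , c' , mw , ob) with moveWork zero mw ls c' rs
...   | (ls' , c'' , rs') = just (cfg s' (moveIn w mi p) ls' c'' rs' (writeOut ob o))

initCfg : (M : TM) → Config M
initCfg M = cfg (TM.start M) 0 [] zero [] []

runTM : (M : TM) → List Bool → ℕ → Config M → Config M
runTM M w zero    c = c
runTM M w (suc t) c with stepTM M w c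
... | nothing = c
... | just c' = runTM M w t c'

cfgAt : (M : TM) → List Bool → ℕ → Config M
cfgAt M w t = runTM M w t (initCfg M)

workSpace : {M : TM} → Config M → ℕ
workSpace c = length (Config.left c) + suc (length (Config.right c))

LogSpaceRun : TM → ℕ → List Bool → List Bool → Set
LogSpaceRun M c w out = Σ ℕ λ t →
  (stepTM M w (cfgAt M w t) ≡ nothing) ×
  (reverse (Config.outR (cfgAt M w t)) ≡ out) ×
  (∀ i → i ≤ t → workSpace (cfgAt M w i) ≤ c * suc ⌊log₂ length w ⌋)

encodeNats : List ℕ → List Bool
encodeNats []       = []
encodeNats (k ∷ ks) = replicate k true ++ false ∷ encodeNats ks

bitN : Bool → ℕ
bitN false = 0
bitN true  = 1

-- Boolean circuits (gates refer to earlier gates / inputs by index;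
-- a dangling reference reads as false).

data Gate : Set where
  inp : ℕ → Gate
  cst : Bool → Gate
  not : ℕ → Gate
  and : ℕ → ℕ → Gate
  or  : ℕ → ℕ → Gate

record Circuit : Set where
  field
    gates : List Gate
    outs  : List ℕ

getD : List Bool → ℕ → Bool
getD []       _       = false
getD (b ∷ bs) zero    = b
getD (b ∷ bs) (suc i) = getD bs i

gateVal : List Bool → List Bool → Gate → Bool
gateVal ins vals (inp i)   = getD ins i
gateVal ins vals (cst b)   = b
gateVal ins vals (not a)   = if getD vals a then false else true
gateVal ins vals (and a b) = if getD vals a then getD vals b else false
gateVal ins vals (or a b)  = if getD vals a then true else getD vals b

evalGates : List Bool → List Bool → List Gate → List Bool
evalGates ins vals []       = vals
evalGates ins vals (g ∷ gs) = evalGates ins (vals ++ [ gateVal ins vals g ]) gs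

evalCircuit : Circuit → List Bool → List Bool
evalCircuit C ins = map (getD (evalGates ins [] (Circuit.gates C))) (Circuit.outs C)

gateCode : Gate → List ℕ
gateCode (inp i)   = 0 ∷ i ∷ []
gateCode (cst b)   = 1 ∷ bitN b ∷ []
gateCode (not a)   = 2 ∷ a ∷ []
gateCode (and a b) = 3 ∷ a ∷ b ∷ []
gateCode (or a b)  = 4 ∷ a ∷ b ∷ []

circuitCode : Circuit → List ℕ
circuitCode C = length (Circuit.gates C) ∷ concat (map gateCode (Circuit.gates C))
                ++ length (Circuit.outs C) ∷ Circuit.outs C

-- the fixed injective m_Q : Fin q → {0,1}^q (one-hot), extended cellwise
encState : {q : ℕ} → Fin q → List Bool
encState {q} a = map (λ j → ⌊ a ≟ j ⌋) (allFin q)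

encConfig : {q n : ℕ} → (Fin n → Fin q) → List Bool
encConfig {n = n} x = concat (map (λ v → encState (x v)) (allFin n))

IsCircuitEncoding : AN → Circuit → Set
IsCircuitEncoding A C = ∀ (x : Fin (AN.n A) → Fin (AN.q A)) →
  evalCircuit C (encConfig x) ≡ encConfig (AN.F A x)

-- A family with a standard representation: a language, the member each
-- word represents, and a log-space machine producing a circuit encoding
-- of that member from the word.  (The family is the set of represented
-- members.)

record RepFamily : Set₁ where
  field
    Lang  : List Bool → Set
    net   : (w : List Bool) → Lang w → AN
    circM : TM
    circC : ℕ
    circ  : ∀ (w : List Bool) (p : Lang w) → Σ Circuit λ C →
              IsCircuitEncoding (net w p) C ×
              LogSpaceRun circM circC w (encodeNats (circuitCode C))

HasPolyBallGrowth : RepFamily → Set₁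
HasPolyBallGrowth R =
  Σ ((i : Σ (List Bool) (RepFamily.Lang R)) →
        Fin (AN.n (RepFamily.net R (Σ.proj₁ i) (Σ.proj₂ i))) →
        Fin (AN.n (RepFamily.net R (Σ.proj₁ i) (Σ.proj₂ i))) → Set) λ E →
    (∀ i → IsCommGraph (RepFamily.net R (Σ.proj₁ i) (Σ.proj₂ i)) (E i)) ×
    PolyBallGrowth (Σ (List Bool) (RepFamily.Lang R))
                   (λ i → AN.n (RepFamily.net R (Σ.proj₁ i) (Σ.proj₂ i))) E

record BNet (q Δ : ℕ) : Set where
  field
    n      : ℕ
    nb     : Fin n → List (Fin n)                       -- in-neighbours
    tab    : (v : Fin n) → Fin (q ^ length (nb v)) → Fin q
    indeg  : ∀ v → length (nb v) ≤ Δ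
    outdeg : ∀ u → CardLE (λ v → u ∈ nb v) Δ

tupleIndex : {n q : ℕ} → (Fin n → Fin q) → (us : List (Fin n)) → Fin (q ^ length us)
tupleIndex x []       = zero
tupleIndex x (u ∷ us) = combine (x u) (tupleIndex x us)

bnetAN : {q Δ : ℕ} → BNet q Δ → AN
bnetAN {q} b = record
  { q = q ; n = BNet.n b
  ; F = λ x v → BNet.tab b v (tupleIndex x (BNet.nb b v)) }

encodeBNet : {q Δ : ℕ} → BNet q Δ → List Bool
encodeBNet {q} b = encodeNats (BNet.n b ∷ concat (map nodeCode (allFin (BNet.n b))))
  where
  nodeCode : Fin (BNet.n b) → List ℕ
  nodeCode v = length (BNet.nb b v) ∷ map toℕ (BNet.nb b v)
               ++ map (λ j → toℕ (BNet.tab b v j)) (allFin (q ^ length (BNet.nb b v)))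

record BlockEmb (qH nH qG nG : ℕ) : Set where
  field
    blk : Fin nG → Fin nH                    -- u ∈ D_(blk u)
    pat : Fin nH → Fin qH → Fin nG → Fin qG  -- p_{i,a}, relevant on D_i
    inj : ∀ i a a' → (∀ u → blk u ≡ i → pat i a u ≡ pat i a' u) → a ≡ a'

embed : {qH nH qG nG : ℕ} → BlockEmb qH nH qG nG → (Fin nH → Fin qH) → (Fin nG → Fin qG)
embed E x u = BlockEmb.pat E (BlockEmb.blk E u) (x (BlockEmb.blk E u)) u

embCode : {qH nH qG nG : ℕ} → BlockEmb qH nH qG nG → List ℕ
embCode {qH} {nH} {qG} {nG} E = concat (map code (allFin nG))
  where
  code : Fin nG → List ℕ
  code u = toℕ (BlockEmb.blk E u) ∷
           map (λ a → toℕ (BlockEmb.pat E (BlockEmb.blk E u) a u)) (allFin qH)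

SimulatesVia : (G H : AN) → BlockEmb (AN.q H) (AN.n H) (AN.q G) (AN.n G) → ℕ → Set
SimulatesVia G H E T = ∀ (x : Fin (AN.n H) → Fin (AN.q H)) (u : Fin (AN.n G)) →
  embed E (AN.F H x) u ≡ iter (AN.F G) T (embed E x) u

simOutput : (w' : List Bool) → ℕ → List ℕ → List Bool
simOutput w' T e = encodeNats (length w' ∷ map bitN w' ++ T ∷ e)

SimulatesB : RepFamily → ℕ → ℕ → Set
SimulatesB R q Δ =
  Σ TM λ M → Σ ℕ λ c → Σ ℕ λ T → Σ (ℕ → ℕ) λ S → Σ ℕ λ a →
    (∀ n → S n ≤ a * n + a) ×
    (∀ (b : BNet q Δ) → Σ (List Bool) λ w' → Σ (RepFamily.Lang R w') λ p →
       Σ (AN.n (RepFamily.net R w' p) ≡ S (BNet.n b)) λ _ →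
       Σ (BlockEmb q (BNet.n b) (AN.q (RepFamily.net R w' p)) (AN.n (RepFamily.net R w' p))) λ E →
         SimulatesVia (RepFamily.net R w' p) (bnetAN b) E T ×
         LogSpaceRun M c (encodeBNet b) (simOutput w' T (embCode E)))

StronglyUniversal : RepFamily → Set
StronglyUniversal R = ∀ (q Δ : ℕ) → 1 ≤ Δ → SimulatesB R q Δ

{-# OPTIONS --safe #-}
-- A strongly universal family would simulate, in constant time T and on at most a n + a nodes,
-- the doubling network on n = 2 ^ t nodes, in which node v becomes the OR of nodes 2v and 2v + 1
-- (mod n), so that after t steps every node depends on every node.  Some block of the simulating
-- network then has at most 2a nodes, and after t T steps its state only depends on the ball of
-- radius t T around it; that ball must therefore meet all 2 ^ t blocks.  Polynomial ball growth
-- bounds its size by C (t T + 1) ^ k with C independent of t, which is below 2 ^ t for large t.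
module Submission where

open import Defs
open import Data.Bool using (Bool; true; false)
open import Data.Empty using (⊥)
open import Data.Fin as Fin using (Fin; zero; suc; toℕ; fromℕ<; inject≤; combine; remQuot; _≟_)
open import Data.Fin.Properties
  using (toℕ-injective; toℕ<n; toℕ-fromℕ<; inject≤-injective; any?; pigeonhole; injective⇒≤; combine-remQuot)
  renaming (suc-injective to fsuc-injective)
open import Data.List using (List; []; _∷_)
open import Data.List.Membership.Propositional using (_∈_)
open import Data.List.Relation.Unary.Any using (here; there)
open import Data.Nat hiding (_≟_)
open import Data.Nat.DivMod
open import Data.Nat.Properties hiding (_≟_)
open import Data.Nat.Solver using (module +-*-Solver)
open import Data.Product using (Σ; ∃; _×_; _,_; proj₁; proj₂; uncurry)
open import Data.Sum using (inj₁; inj₂)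
open import Function using (_∘_)
open import Function.Definitions using (Injective)
open import Relation.Binary.PropositionalEquality
open import Relation.Nullary using (¬_; yes; no; contradiction)
open import Relation.Unary using (Decidable)

open +-*-Solver

n<2^n : ∀ n → n < 2 ^ n
n<2^n zero    = s≤s z≤n
n<2^n (suc n) = begin
  suc (suc n)   ≡⟨ +-comm 1 (suc n) ⟩
  suc n + 1     ≤⟨ +-mono-≤ (n<2^n n) (m^n>0 2 n) ⟩
  2 ^ n + 2 ^ n ≡⟨ cong (2 ^ n +_) (sym (+-identityʳ (2 ^ n))) ⟩
  2 ^ suc n     ∎
  where open ≤-Reasoning

affine≤2^ : ∀ b k → ∃ λ s → b + s * k ≤ 2 ^ s
affine≤2^ b k = j + j , (begin
  b + (j + j) * k         ≤⟨ +-monoˡ-≤ ((j + j) * k) (m≤n*m b j) ⟩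
  j * b + (j + j) * k     ≡⟨ solve 3 (λ j b k → j :* b :+ (j :+ j) :* k := j :* (b :+ (k :+ k))) refl j b k ⟩
  j * (b + (k + k))       ≤⟨ m≤n+m _ j ⟩
  j + j * (b + (k + k))   ≡⟨ sym (*-suc j (b + (k + k))) ⟩
  j * j                   ≤⟨ *-mono-≤ (<⇒≤ (n<2^n j)) (<⇒≤ (n<2^n j)) ⟩
  2 ^ j * 2 ^ j           ≡⟨ sym (^-distribˡ-+-* 2 j j) ⟩
  2 ^ (j + j)             ∎)
  where
  open ≤-Reasoning
  j = suc (b + (k + k))

-- Take t = 2 ^ s: then 1 + t T ≤ 2 ^ (s + T + 1), and the affine bound on s finishes.
exp-beats-poly : ∀ C k T → ∃ λ t → C * suc (t * T) ^ k < 2 ^ t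
exp-beats-poly C k T = t , (begin-strict
  C * suc (t * T) ^ k           ≤⟨ *-monoʳ-≤ C (^-monoˡ-≤ k radius≤) ⟩
  C * (2 ^ (s + A)) ^ k         ≡⟨ cong (C *_) (^-*-assoc 2 (s + A) k) ⟩
  C * 2 ^ ((s + A) * k)         <⟨ *-monoˡ-< (2 ^ ((s + A) * k)) {{m^n≢0 2 ((s + A) * k)}} (n<2^n C) ⟩
  2 ^ C * 2 ^ ((s + A) * k)     ≡⟨ sym (^-distribˡ-+-* 2 C ((s + A) * k)) ⟩
  2 ^ (C + (s + A) * k)         ≡⟨ cong (2 ^_) (solve 4 (λ C s A k → C :+ (s :+ A) :* k := (C :+ A :* k) :+ s :* k) refl C s A k) ⟩
  2 ^ ((C + A * k) + s * k)     ≤⟨ ^-monoʳ-≤ 2 (proj₂ (affine≤2^ (C + A * k) k)) ⟩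
  2 ^ t                         ∎)
  where
  open ≤-Reasoning
  A = suc T
  s = proj₁ (affine≤2^ (C + A * k) k)
  t = 2 ^ s
  radius≤ : suc (t * T) ≤ 2 ^ (s + A)
  radius≤ = begin
    suc (t * T)     ≤⟨ +-monoˡ-≤ (t * T) (m^n>0 2 s) ⟩
    t + t * T       ≡⟨ sym (*-suc t T) ⟩
    t * A           ≤⟨ *-monoʳ-≤ t (<⇒≤ (n<2^n A)) ⟩
    t * 2 ^ A       ≡⟨ sym (^-distribˡ-+-* 2 s A) ⟩
    2 ^ (s + A)     ∎

affine<*suc : ∀ a n → 1 ≤ n → a * n + a < n * suc (a + a)
affine<*suc a n 1≤n = begin-strict
  a * n + a         ≤⟨ +-monoʳ-≤ (a * n) (m≤m*n a n {{>-nonZero 1≤n}}) ⟩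
  a * n + a * n     <⟨ +-monoˡ-< (a * n + a * n) 1≤n ⟩
  n + (a * n + a * n) ≡⟨ solve 2 (λ a n → n :+ (a :* n :+ a :* n) := n :* (con 1 :+ (a :+ a))) refl a n ⟩
  n * suc (a + a)   ∎
  where open ≤-Reasoning

sumTo : (ℕ → ℕ) → ℕ → ℕ
sumTo f zero    = f zero
sumTo f (suc M) = f (suc M) + sumTo f M

≤-sumTo : ∀ f {m M} → m ≤ M → f m ≤ sumTo f M
≤-sumTo f {M = zero}  z≤n = ≤-refl
≤-sumTo f {m} {suc M} m≤M with m≤n⇒m<n∨m≡n m≤M
... | inj₁ m<M  = ≤-trans (≤-sumTo f (s≤s⁻¹ m<M)) (m≤n+m (sumTo f M) (f (suc M)))
... | inj₂ refl = m≤m+n (f (suc M)) (sumTo f M)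

record Enumeration {N : ℕ} (P : Fin N → Set) : Set where
  field
    size           : ℕ
    elem           : Fin size → Fin N
    elem-injective : Injective _≡_ _≡_ elem
    elem-sound     : ∀ j → P (elem j)
    elem-complete  : ∀ u → P u → ∃ λ j → elem j ≡ u

open Enumeration

Fibre : ∀ {N n} → (Fin N → Fin n) → Fin n → Fin N → Set
Fibre f v u = f u ≡ v

module _ {N : ℕ} {P : Fin (suc N) → Set} where

  enumeration-cons : P zero → Enumeration (P ∘ suc) → Enumeration P
  enumeration-cons p0 e = record
    { size           = suc (size e)
    ; elem           = elem′
    ; elem-injective = injective
    ; elem-sound     = λ { zero → p0 ; (suc j) → elem-sound e j }
    ; elem-complete  = complete
    }
    where
    elem′ : Fin (suc (size e)) → Fin (suc N)
    elem′ zero    = zero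
    elem′ (suc j) = suc (elem e j)
    injective : Injective _≡_ _≡_ elem′
    injective {zero}  {zero}  _  = refl
    injective {suc i} {suc j} eq = cong suc (elem-injective e (fsuc-injective eq))
    complete : ∀ u → P u → ∃ λ j → elem′ j ≡ u
    complete zero    _  = zero , refl
    complete (suc u) pu with elem-complete e u pu
    ... | j , refl = suc j , refl

  enumeration-skip : ¬ P zero → Enumeration (P ∘ suc) → Enumeration P
  enumeration-skip ¬p0 e = record
    { size           = size e
    ; elem           = suc ∘ elem e
    ; elem-injective = elem-injective e ∘ fsuc-injective
    ; elem-sound     = elem-sound e
    ; elem-complete  = complete
    }
    where
    complete : ∀ u → P u → ∃ λ j → suc (elem e j) ≡ u
    complete zero    p0 = contradiction p0 ¬p0
    complete (suc u) pu with elem-complete e u pu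
    ... | j , refl = j , refl

enumerate : ∀ {N} {P : Fin N → Set} → Decidable P → Enumeration P
enumerate {zero}  P? = record
  { size = 0 ; elem = λ () ; elem-injective = λ { {()} } ; elem-sound = λ () ; elem-complete = λ () }
enumerate {suc N} P? with P? zero
... | yes p0  = enumeration-cons p0  (enumerate (P? ∘ suc))
... | no  ¬p0 = enumeration-skip ¬p0 (enumerate (P? ∘ suc))

remQuot-injective : ∀ {m} n {i j : Fin (m * n)} → remQuot {m} n i ≡ remQuot n j → i ≡ j
remQuot-injective {m} n {i} {j} eq =
  trans (sym (combine-remQuot {m} n i)) (trans (cong (uncurry combine) eq) (combine-remQuot {m} n j))

enumerate-fibre : ∀ {N n} (f : Fin N → Fin n) v → Enumeration (Fibre f v)
enumerate-fibre f v = enumerate (λ u → f u ≟ v)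

-- If all n fibres had more than c points, picking c + 1 of them in each would inject n (c + 1) points into Fin N.
small-fibre : ∀ {N n} c (f : Fin N → Fin n) → N < n * suc c →
              ∃ λ v → Σ (Enumeration (Fibre f v)) λ e → size e ≤ c
small-fibre {N} {n} c f N<n[1+c] with any? (λ v → size (enumerate-fibre f v) ≤? c)
... | yes (v , small) = v , enumerate-fibre f v , small
... | no none = contradiction (injective⇒≤ pick∘remQuot-injective) (<⇒≱ N<n[1+c])
  where
  fibre : ∀ v → Enumeration (Fibre f v)
  fibre = enumerate-fibre f
  large : ∀ v → suc c ≤ size (fibre v)
  large v = ≰⇒> (none ∘ (v ,_))
  pick : Fin n × Fin (suc c) → Fin N
  pick (v , j) = elem (fibre v) (inject≤ j (large v))
  pick-injective : Injective _≡_ _≡_ pick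
  pick-injective {v , i} {w , j} eq
    with trans (sym (elem-sound (fibre v) _)) (trans (cong f eq) (elem-sound (fibre w) _))
  ... | refl = cong (v ,_) (inject≤-injective _ _ i j (elem-injective (fibre v) eq))
  pick∘remQuot-injective : Injective _≡_ _≡_ (pick ∘ remQuot {n} (suc c))
  pick∘remQuot-injective = remQuot-injective {n} (suc c) ∘ pick-injective

¬¬-∀-Fin : ∀ {n} {P : Fin n → Set} → (∀ i → ¬ ¬ P i) → ¬ ¬ (∀ i → P i)
¬¬-∀-Fin {zero}      _   ¬all = ¬all λ ()
¬¬-∀-Fin {suc n} {P} ¬¬P ¬all =
  ¬¬P zero λ p0 → ¬¬-∀-Fin (¬¬P ∘ suc) λ ps → ¬all λ { zero → p0 ; (suc i) → ps i }

covering⇒¬CardLE : ∀ {N n b} {S : Fin N → Set} (f : Fin N → Fin n) →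
                   (∀ v → ∃ λ u → S u × f u ≡ v) → b < n → ¬ CardLE S b
covering⇒¬CardLE {N} {n} f cover b<n card = card (pick ∘ λ j → inject≤ j b<n) pick-injective (λ j → proj₁ (proj₂ (cover _)))
  where
  pick : Fin n → Fin N
  pick v = proj₁ (cover v)
  pick-injective : Injective _≡_ _≡_ (pick ∘ λ j → inject≤ j b<n)
  pick-injective {i} {j} eq = inject≤-injective b<n b<n i j
    (trans (sym (proj₂ (proj₂ (cover _)))) (trans (cong f eq) (proj₂ (proj₂ (cover _)))))

iter-+ : ∀ {A : Set} (f : A → A) a b x → iter f (a + b) x ≡ iter f a (iter f b x)
iter-+ f zero    b x = refl
iter-+ f (suc a) b x = cong f (iter-+ f a b x)

Within-suc : ∀ {N} {E : Fin N → Fin N → Set} {r u v} → Within E r u v → Within E (suc r) u v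
Within-suc here       = here
Within-suc (step e w) = step e (Within-suc w)

module _ (G : AN) {E : Fin (AN.n G) → Fin (AN.n G) → Set} (comm : IsCommGraph G E) where

  private
    F : (Fin (AN.n G) → Fin (AN.q G)) → Fin (AN.n G) → Fin (AN.q G)
    F = AN.F G

  iter-local : ∀ r x y w → (∀ w′ → Within E r w w′ → x w′ ≡ y w′) → iter F r x w ≡ iter F r y w
  iter-local zero    x y w agree = agree w here
  iter-local (suc r) x y w agree =
    comm w _ _ λ u u→w → iter-local r x y u λ w′ near → agree w′ (step (inj₂ u→w) near)

  module _ {H : AN} {Em : BlockEmb (AN.q H) (AN.n H) (AN.q G) (AN.n G)} {T : ℕ}
           (sim : SimulatesVia G H Em T) where

    open BlockEmb Em

    simulates-iter : ∀ s x u → embed Em (iter (AN.F H) s x) u ≡ iter F (s * T) (embed Em x) u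
    simulates-iter zero    x u = refl
    simulates-iter (suc s) x u = begin
      embed Em (AN.F H (iter (AN.F H) s x)) u    ≡⟨ sim _ u ⟩
      iter F T (embed Em (iter (AN.F H) s x)) u  ≡⟨ iter-local T _ _ u (λ w _ → simulates-iter s x w) ⟩
      iter F T (iter F (s * T) (embed Em x)) u   ≡⟨ cong (λ z → z u) (iter-+ F T (s * T) (embed Em x)) ⟨
      iter F (suc s * T) (embed Em x) u          ∎
      where open ≡-Reasoning

    -- The state of v is read off its block, and s T steps of G only see the ball of radius s T.
    block-state-local : ∀ {v} (X : Enumeration (Fibre blk v)) s x y →
      (∀ w → Ball E (elem X) (s * T) w → x (blk w) ≡ y (blk w)) →
      iter (AN.F H) s x v ≡ iter (AN.F H) s y v
    block-state-local {v} X s x y agree = inj v _ _ λ w w∈v → pattern-agree w∈v (block-agree w w∈v)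
      where
      embeddings-agree : ∀ j → embed Em (iter (AN.F H) s x) (elem X j) ≡ embed Em (iter (AN.F H) s y) (elem X j)
      embeddings-agree j = begin
        embed Em (iter (AN.F H) s x) (elem X j)   ≡⟨ simulates-iter s x (elem X j) ⟩
        iter F (s * T) (embed Em x) (elem X j)    ≡⟨ iter-local (s * T) _ _ (elem X j) (λ w near →
                                                       cong (λ a → pat (blk w) a w) (agree w (j , near))) ⟩
        iter F (s * T) (embed Em y) (elem X j)    ≡⟨ simulates-iter s y (elem X j) ⟨
        embed Em (iter (AN.F H) s y) (elem X j)   ∎
        where open ≡-Reasoning
      block-agree : ∀ w → blk w ≡ v → embed Em (iter (AN.F H) s x) w ≡ embed Em (iter (AN.F H) s y) w
      block-agree w w∈v with elem-complete X w w∈v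
      ... | j , refl = embeddings-agree j
      pattern-agree : ∀ {w u} {a b : Fin (AN.n H) → Fin (AN.q H)} → blk w ≡ u →
                      embed Em a w ≡ embed Em b w → pat u (a u) w ≡ pat u (b u) w
      pattern-agree refl eq = eq

[m*[n%d]+o]%d≡[m*n+o]%d : ∀ m n o d .{{_ : NonZero d}} → (m * (n % d) + o) % d ≡ (m * n + o) % d
[m*[n%d]+o]%d≡[m*n+o]%d m n o d = begin
  (m * (n % d) + o) % d                 ≡⟨ %-distribˡ-+ (m * (n % d)) o d ⟩
  (m * (n % d) % d + o % d) % d         ≡⟨ cong (λ z → (z + o % d) % d) (%-distribˡ-* m (n % d) d) ⟩
  ((m % d) * (n % d % d) % d + o % d) % d ≡⟨ cong (λ z → ((m % d) * z % d + o % d) % d) (m%n%n≡m%n n d) ⟩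
  ((m % d) * (n % d) % d + o % d) % d   ≡⟨ cong (λ z → (z + o % d) % d) (%-distribˡ-* m n d) ⟨
  (m * n % d + o % d) % d               ≡⟨ %-distribˡ-+ (m * n) o d ⟨
  (m * n + o) % d                       ∎
  where open ≡-Reasoning

divMod-injective : ∀ {m o} n .{{_ : NonZero n}} → m % n ≡ o % n → m / n ≡ o / n → m ≡ o
divMod-injective {m} {o} n rem quot = begin
  m                  ≡⟨ m≡m%n+[m/n]*n m n ⟩
  m % n + m / n * n  ≡⟨ cong₂ (λ r q → r + q * n) rem quot ⟩
  o % n + o / n * n  ≡⟨ m≡m%n+[m/n]*n o n ⟨
  o                  ∎
  where open ≡-Reasoning

2*m+bit-injective : ∀ m n b c → 2 * m + bitN b ≡ 2 * n + bitN c → m ≡ n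
2*m+bit-injective m n false false eq = *-cancelˡ-≡ m n 2 (trans (sym (+-identityʳ _)) (trans eq (+-identityʳ _)))
2*m+bit-injective m n false true  eq = contradiction (trans (sym (+-identityʳ _)) (trans eq (+-comm _ 1))) (even≢odd m n)
2*m+bit-injective m n true  false eq = contradiction (trans (sym (+-identityʳ _)) (trans (sym eq) (+-comm _ 1))) (even≢odd n m)
2*m+bit-injective m n true  true  eq = *-cancelˡ-≡ m n 2 (+-cancelʳ-≡ 1 _ _ eq)

2*m+bit<2*n : ∀ {m n} b → m < n → 2 * m + bitN b < 2 * n
2*m+bit<2*n {m} {n} b m<n = begin-strict
  2 * m + bitN b  <⟨ +-monoʳ-< (2 * m) (bit<2 b) ⟩
  2 * m + 2       ≡⟨ +-comm (2 * m) 2 ⟩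
  2 + 2 * m       ≡⟨ *-suc 2 m ⟨
  2 * suc m       ≤⟨ *-monoʳ-≤ 2 m<n ⟩
  2 * n           ∎
  where
  open ≤-Reasoning
  bit<2 : ∀ b → bitN b < 2
  bit<2 false = s≤s z≤n
  bit<2 true  = s≤s (s≤s z≤n)

split-<2* : ∀ {r} p → r < 2 * p → ∃ λ b → Σ ℕ λ r′ → r′ < p × r ≡ bitN b * p + r′
split-<2* {r} p r<2p with r <? p
... | yes r<p = false , r , r<p , refl
... | no  r≮p = true , r ∸ p , +-cancelˡ-< p (r ∸ p) p r∸p+p<p+p ,
                 trans (sym (m+[n∸m]≡n p≤r)) (cong (_+ (r ∸ p)) (sym (+-identityʳ p)))
  where
  p≤r = ≮⇒≥ r≮p
  r∸p+p<p+p : p + (r ∸ p) < p + p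
  r∸p+p<p+p = subst₂ _<_ (sym (m+[n∸m]≡n p≤r)) (cong (p +_) (+-identityʳ p)) r<2p

module DoublingNetwork (t : ℕ) where

  n : ℕ
  n = 2 ^ t

  instance
    n≢0 : NonZero n
    n≢0 = m^n≢0 2 t

  one : Fin 2
  one = suc zero

  child : Fin n → Bool → Fin n
  child v b = (2 * toℕ v + bitN b) mod n

  ≡-mod : ∀ {m o} → m % n ≡ o % n → m mod n ≡ o mod n
  ≡-mod eq = toℕ-injective (trans (toℕ-fromℕ< _) (trans eq (sym (toℕ-fromℕ< _))))

  in-nbrs : Fin n → List (Fin n)
  in-nbrs v = child v false ∷ child v true ∷ []

  ∈-in-nbrs : ∀ {u} v → u ∈ in-nbrs v → ∃ λ b → u ≡ child v b
  ∈-in-nbrs v (here eq)         = false , eq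
  ∈-in-nbrs v (there (here eq)) = true , eq

  position : ∀ {u} v → u ∈ in-nbrs v → ℕ
  position v u∈ = 2 * toℕ v + bitN (proj₁ (∈-in-nbrs v u∈))

  position%n : ∀ {u} v (u∈ : u ∈ in-nbrs v) → position v u∈ % n ≡ toℕ u
  position%n v u∈ with ∈-in-nbrs v u∈
  ... | b , u≡child = trans (sym (toℕ-fromℕ< _)) (cong toℕ (sym u≡child))

  position-injective : ∀ {u} v w (u∈v : u ∈ in-nbrs v) (u∈w : u ∈ in-nbrs w) →
                       position v u∈v ≡ position w u∈w → v ≡ w
  position-injective v w _ _ eq = toℕ-injective (2*m+bit-injective (toℕ v) (toℕ w) _ _ eq)

  quotient : ∀ {u} v → u ∈ in-nbrs v → Fin 2
  quotient v u∈ = fromℕ< (m<n*o⇒m/o<n (2*m+bit<2*n (proj₁ (∈-in-nbrs v u∈)) (toℕ<n v)))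

  -- A position 2 v + b < 2 n is determined by its remainder, which is u, and its quotient, which is 0 or 1.
  three-in-nbrs-collide : ∀ {u} (f : Fin 3 → Fin n) → (∀ j → u ∈ in-nbrs (f j)) →
                          ∃ λ i → ∃ λ j → i Fin.< j × f i ≡ f j
  three-in-nbrs-collide f u∈ with pigeonhole (s≤s (s≤s (s≤s z≤n))) (λ j → quotient (f j) (u∈ j))
  ... | i , j , i<j , same = i , j , i<j , position-injective (f i) (f j) (u∈ i) (u∈ j)
        (divMod-injective n (trans (position%n (f i) (u∈ i)) (sym (position%n (f j) (u∈ j))))
          (trans (sym (toℕ-fromℕ< _)) (trans (cong toℕ same) (toℕ-fromℕ< _))))

  out-degree≤2 : ∀ u → CardLE (λ v → u ∈ in-nbrs v) 2
  out-degree≤2 u f f-injective u∈ = collision (three-in-nbrs-collide f u∈)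
    where
    collision : (∃ λ i → ∃ λ j → i Fin.< j × f i ≡ f j) → ⊥
    collision (i , j , i<j , fi≡fj) = <-irrefl (cong toℕ (f-injective fi≡fj)) i<j

  or-table : Fin 4 → Fin 2
  or-table zero    = zero
  or-table (suc _) = one

  network : BNet 2 2
  network = record
    { n = n ; nb = in-nbrs ; tab = λ _ → or-table ; indeg = λ _ → ≤-refl ; outdeg = out-degree≤2 }

  F : (Fin n → Fin 2) → Fin n → Fin 2
  F = AN.F (bnetAN network)

  step-zero : ∀ x v → x (child v false) ≡ zero → x (child v true) ≡ zero → F x v ≡ zero
  step-zero x v x₀≡0 x₁≡0 rewrite x₀≡0 | x₁≡0 = refl

  step-one : ∀ x v b → x (child v b) ≡ one → F x v ≡ one
  step-one x v false x₀≡1 rewrite x₀≡1 = refl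
  step-one x v true  x₁≡1 rewrite x₁≡1 with x (child v false)
  ... | zero     = refl
  ... | suc zero = refl

  iter-zeros : ∀ s v → iter F s (λ _ → zero) v ≡ zero
  iter-zeros zero    v = refl
  iter-zeros (suc s) v = step-zero (iter F s (λ _ → zero)) v (iter-zeros s _) (iter-zeros s _)

  mod-≡ : ∀ {m} w → m % n ≡ toℕ w → m mod n ≡ w
  mod-≡ w eq = toℕ-injective (trans (toℕ-fromℕ< _) eq)

  -- A one at node 2 ^ s v + r, r < 2 ^ s, reaches v in s steps: peel off the top bit b of r and
  -- pass through the child 2 v + b.
  iter-reaches : ∀ s v r → r < 2 ^ s → (y : Fin n → Fin 2) →
                 y ((2 ^ s * toℕ v + r) mod n) ≡ one → iter F s y v ≡ one
  iter-reaches zero    v r (s≤s z≤n) y y≡one =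
    trans (cong y (sym (mod-≡ v (trans (cong (_% n) (solve 1 (λ v → con 1 :* v :+ con 0 := v) refl (toℕ v)))
                                        (m<n⇒m%n≡m (toℕ<n v)))))) y≡one
  iter-reaches (suc s) v r r<2^[1+s] y y≡one with split-<2* (2 ^ s) r<2^[1+s]
  ... | b , r′ , r′<2^s , refl =
    step-one (iter F s y) v b (iter-reaches s (child v b) r′ r′<2^s y (trans (cong y same-node) y≡one))
    where
    same-node : (2 ^ s * toℕ (child v b) + r′) mod n ≡ (2 ^ suc s * toℕ v + (bitN b * 2 ^ s + r′)) mod n
    same-node = ≡-mod (begin
      (2 ^ s * toℕ (child v b) + r′) % n                ≡⟨ cong (λ c → (2 ^ s * c + r′) % n) (toℕ-fromℕ< _) ⟩
      (2 ^ s * ((2 * toℕ v + bitN b) % n) + r′) % n     ≡⟨ [m*[n%d]+o]%d≡[m*n+o]%d (2 ^ s) _ r′ n ⟩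
      (2 ^ s * (2 * toℕ v + bitN b) + r′) % n           ≡⟨ cong (_% n) (solve 4 (λ p v b r →
                                                             p :* (con 2 :* v :+ b) :+ r := (con 2 :* p) :* v :+ (b :* p :+ r))
                                                             refl (2 ^ s) (toℕ v) (bitN b) r′) ⟩
      (2 ^ suc s * toℕ v + (bitN b * 2 ^ s + r′)) % n   ∎)
      where open ≡-Reasoning

  indicator : Fin n → Fin n → Fin 2
  indicator u w with w ≟ u
  ... | yes _ = one
  ... | no  _ = zero

  indicator-other : ∀ {u w} → w ≢ u → indicator u w ≡ zero
  indicator-other {u} {w} w≢u with w ≟ u
  ... | yes w≡u = contradiction w≡u w≢u
  ... | no  _   = refl

  indicator-self : ∀ u → indicator u u ≡ one
  indicator-self u with u ≟ u
  ... | yes _   = refl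
  ... | no  u≢u = contradiction refl u≢u

  iter-indicator : ∀ u v → iter F t (indicator u) v ≡ one
  iter-indicator u v = iter-reaches t v (toℕ u) (toℕ<n u) (indicator u)
    (trans (cong (indicator u) node≡u) (indicator-self u))
    where
    node≡u : (n * toℕ v + toℕ u) mod n ≡ u
    node≡u = mod-≡ u (begin
      (n * toℕ v + toℕ u) % n   ≡⟨ cong (_% n) (solve 3 (λ n v u → n :* v :+ u := u :+ v :* n) refl n (toℕ v) (toℕ u)) ⟩
      (toℕ u + toℕ v * n) % n   ≡⟨ [m+kn]%n≡m%n (toℕ u) (toℕ v) n ⟩
      toℕ u % n                 ≡⟨ m<n⇒m%n≡m (toℕ<n u) ⟩
      toℕ u                     ∎)
      where open ≡-Reasoning

open DoublingNetwork using (network; F; iter-zeros; iter-indicator; indicator; indicator-other)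

Ball-suc : ∀ {N m} {E : Fin N → Fin N → Set} {X : Fin m → Fin N} {r w} → Ball E X r w → Ball E X (suc r) w
Ball-suc (j , near) = j , Within-suc near

-- The all-zero configuration and the indicator of u disagree at v after t steps, so the ball
-- around the block of v must meet the block of every u.
doubling-simulation-needs-large-balls :
  (G : AN) {E : Fin (AN.n G) → Fin (AN.n G) → Set} → IsCommGraph G E →
  ∀ t {T} {Em : BlockEmb 2 (2 ^ t) (AN.q G) (AN.n G)} → SimulatesVia G (bnetAN (network t)) Em T →
  ∀ {v} (X : Enumeration (Fibre (BlockEmb.blk Em) v)) {b} → b < 2 ^ t →
  ¬ CardLE (Ball E (elem X) (suc (t * T))) b
doubling-simulation-needs-large-balls G {E} comm t {T} {Em} sim {v} X b<2^t card =
  ¬¬-∀-Fin meets-every-block λ cover → covering⇒¬CardLE (BlockEmb.blk Em) cover b<2^t card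
  where
  meets-every-block : ∀ u → ¬ ¬ (∃ λ w → Ball E (elem X) (suc (t * T)) w × BlockEmb.blk Em w ≡ u)
  meets-every-block u far = zero≢one (begin
    zero                               ≡⟨ iter-zeros t t v ⟨
    iter (F t) t (λ _ → zero) v        ≡⟨ block-state-local G comm {Em = Em} {T = T} sim X t _ _ agree ⟩
    iter (F t) t (indicator t u) v     ≡⟨ iter-indicator t u v ⟩
    suc zero                           ∎)
    where
    open ≡-Reasoning
    zero≢one : zero ≢ suc {1} zero
    zero≢one ()
    agree : ∀ w → Ball E (elem X) (t * T) w → zero ≡ indicator t u (BlockEmb.blk Em w)
    agree w near = sym (indicator-other t λ w∈u → far (w , Ball-suc near , w∈u))

mainTheorem6 : (R : RepFamily) → HasPolyBallGrowth R → ¬ StronglyUniversal R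
mainTheorem6 R (E , comm , k , growth) universal
  with universal 2 2 (s≤s z≤n)
... | _ , _ , T , S , a , S-linear , simulate
  with exp-beats-poly (sumTo (proj₁ ∘ growth) (a + a)) k T
... | t , t-large
  with simulate (network t)
... | w , p , size≡ , Em , sim , _
  with small-fibre (a + a) (BlockEmb.blk Em)
         (≤-<-trans (≤-trans (≤-reflexive size≡) (S-linear (2 ^ t))) (affine<*suc a (2 ^ t) (m^n>0 2 t)))
... | v , X , small =
  doubling-simulation-needs-large-balls (RepFamily.net R w p) (comm (w , p)) t {Em = Em} sim X
    (≤-<-trans (*-monoˡ-≤ (suc (t * T) ^ k) (≤-sumTo (proj₁ ∘ growth) small)) t-large)
    (proj₂ (growth (size X)) (w , p) (elem X) (elem-injective X) (suc (t * T)) (s≤s z≤n))
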